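{- Let $n$ be a positive integer. Any set of mutually weakly unbiased Hadamard matrices of order $n$ has size at most $2$.
   Context: A Hadamard matrix of order $n$ is an $n\times n$ $(\pm1)$-matrix $H$ with $HH^T=nI_n$. Two Hadamard matrices $H,K$ of order $n$ are weakly unbiased if, writing $a_{ij}$ for the $(i,j)$-entry of $HK^T$, one has $a_{ij}\equiv 2\pmod 4$ for all $i,j$ and $|\{|a_{ij}|: i,j\in\{1,\ldots,n\}\}|\le 2$; by convention the paper excludes unbiased pairs (those with $|a_{ij}|=\sqrt n$ for all $i,j$), so that the set of absolute values has exactly two elements. A set of Hadamard matrices is mutually weakly unbiased if every pair of two distinct members is weakly unbiased. -}

module Defs where

open import Data.Nat using (ℕ; zero; suc)
open import Data.Fin using (Fin; zero; suc)
open import Data.Integer using (ℤ; +_; -_; _+_; _-_; _*_; ∣_∣)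
open import Data.Integer.Divisibility using (_∣_)
open import Data.Product using (_×_; Σ; ∃; ∃-syntax; _,_)
open import Data.Sum using (_⊎_)
open import Relation.Binary.PropositionalEquality using (_≡_; _≢_)

Matrix : ℕ → Set
Matrix n = Fin n → Fin n → ℤ

∑ : (n : ℕ) → (Fin n → ℤ) → ℤ
∑ zero    f = + 0
∑ (suc n) f = f zero + ∑ n (λ k → f (suc k))

_·ᵀ_ : {n : ℕ} → Matrix n → Matrix n → Matrix n
_·ᵀ_ {n} H K i j = ∑ n (λ k → H i k * K j k)

IsPM1 : {n : ℕ} → Matrix n → Set
IsPM1 H = ∀ i j → (H i j ≡ + 1) ⊎ (H i j ≡ - (+ 1))

IsHadamard : (n : ℕ) → Matrix n → Set
IsHadamard n H =
  IsPM1 H ×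
  (∀ i j → (i ≡ j → (H ·ᵀ H) i j ≡ + n) × (i ≢ j → (H ·ᵀ H) i j ≡ + 0))

WeaklyUnbiased : (n : ℕ) → Matrix n → Matrix n → Set
WeaklyUnbiased n H K =
  (∀ i j → (+ 4) ∣ ((H ·ᵀ K) i j - + 2)) ×
  Σ ℕ λ x → Σ ℕ λ y → x ≢ y ×
    (∀ i j → (∣ (H ·ᵀ K) i j ∣ ≡ x) ⊎ (∣ (H ·ᵀ K) i j ∣ ≡ y)) ×
    (∃[ i ] ∃[ j ] ∣ (H ·ᵀ K) i j ∣ ≡ x) ×
    (∃[ i ] ∃[ j ] ∣ (H ·ᵀ K) i j ∣ ≡ y)

-- a set of m Hadamard matrices of order n, given as an injective family
-- (distinct members), mutually weakly unbiased
MutuallyWeaklyUnbiased : (n m : ℕ) → (Fin m → Matrix n) → Set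
MutuallyWeaklyUnbiased n m F =
  (∀ a → IsHadamard n (F a)) ×
  (∀ a b → a ≢ b → WeaklyUnbiased n (F a) (F b))

-- For signs u, v, w ∈ {±1}, 1 + u w - u v - v w = (1 - u v)(1 - v w) is a
-- product of two elements of {0, 2}, so for (±1)-vectors of length n,
-- n + ⟨u,w⟩ - ⟨u,v⟩ - ⟨v,w⟩ ≡ 0 (mod 4). Applied to the first rows of three
-- mutually weakly unbiased Hadamard matrices, whose inner products are all
-- ≡ 2, this gives n ≡ 2 (mod 4), impossible for n = 1. For n ≥ 2, applied to
-- two orthogonal rows of one matrix and a row of another, it gives n ≡ 0.
-- Neither the condition on absolute values nor distinctness is needed.
module Submission where

open import Defs
open import Data.Nat using (ℕ; zero; suc; _≤_; s≤s; z≤n)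
import Data.Nat.Divisibility as ℕ
open import Data.Fin using (Fin; zero; suc)
open import Data.Integer using (ℤ; +_; -_; _+_; _-_; _*_)
open import Data.Integer.Divisibility.Signed
  using (_∣_; divides; ∣ᵤ⇒∣; ∣⇒∣ᵤ; ∣m∣n⇒∣m+n; ∣m∣n⇒∣m-n)
open import Data.Integer.Tactic.RingSolver using (solve-∀)
open import Data.Product using (_,_; proj₁; proj₂)
open import Data.Sum using (_⊎_; inj₁; inj₂)
open import Data.Empty using (⊥-elim)
open import Relation.Nullary using (¬_)
open import Relation.Binary.PropositionalEquality using (_≡_; refl; subst; sym)

IsSign : ℤ → Set
IsSign x = (x ≡ + 1) ⊎ (x ≡ - (+ 1))

infix 7 _∙_

_∙_ : {n : ℕ} → (Fin n → ℤ) → (Fin n → ℤ) → ℤ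
_∙_ {n} u v = ∑ n (λ k → u k * v k)

4∣1+uw-uv-vw : ∀ {u v w} → IsSign u → IsSign v → IsSign w →
               + 4 ∣ + 1 + u * w - u * v - v * w
4∣1+uw-uv-vw (inj₁ refl) (inj₁ refl) (inj₁ refl) = divides (+ 0) refl
4∣1+uw-uv-vw (inj₁ refl) (inj₁ refl) (inj₂ refl) = divides (+ 0) refl
4∣1+uw-uv-vw (inj₁ refl) (inj₂ refl) (inj₁ refl) = divides (+ 1) refl
4∣1+uw-uv-vw (inj₁ refl) (inj₂ refl) (inj₂ refl) = divides (+ 0) refl
4∣1+uw-uv-vw (inj₂ refl) (inj₁ refl) (inj₁ refl) = divides (+ 0) refl
4∣1+uw-uv-vw (inj₂ refl) (inj₁ refl) (inj₂ refl) = divides (+ 1) refl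
4∣1+uw-uv-vw (inj₂ refl) (inj₂ refl) (inj₁ refl) = divides (+ 0) refl
4∣1+uw-uv-vw (inj₂ refl) (inj₂ refl) (inj₂ refl) = divides (+ 0) refl

4∣n+u∙w-u∙v-v∙w : ∀ {n} (u v w : Fin n → ℤ) →
                  (∀ k → IsSign (u k)) → (∀ k → IsSign (v k)) → (∀ k → IsSign (w k)) →
                  + 4 ∣ + n + u ∙ w - u ∙ v - v ∙ w
4∣n+u∙w-u∙v-v∙w {zero}  _ _ _ _  _  _  = divides (+ 0) refl
4∣n+u∙w-u∙v-v∙w {suc n} u v w su sv sw =
  subst (+ 4 ∣_) (sym (regroup (+ n) (u zero * w zero) (u zero * v zero) (v zero * w zero)
                                (tail u ∙ tail w) (tail u ∙ tail v) (tail v ∙ tail w)))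
    (∣m∣n⇒∣m+n (4∣1+uw-uv-vw (su zero) (sv zero) (sw zero))
               (4∣n+u∙w-u∙v-v∙w (tail u) (tail v) (tail w)
                                (λ k → su (suc k)) (λ k → sv (suc k)) (λ k → sw (suc k))))
  where
  tail : (Fin (suc n) → ℤ) → Fin n → ℤ
  tail x k = x (suc k)
  regroup : ∀ m a b c A B C →
            + 1 + m + (a + A) - (b + B) - (c + C) ≡ (+ 1 + a - b - c) + (m + A - B - C)
  regroup = solve-∀

signVectors⇒4∣n-2 : ∀ {n} (u v w : Fin n → ℤ) →
  (∀ k → IsSign (u k)) → (∀ k → IsSign (v k)) → (∀ k → IsSign (w k)) →
  + 4 ∣ u ∙ v - + 2 → + 4 ∣ v ∙ w - + 2 → + 4 ∣ u ∙ w - + 2 →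
  + 4 ∣ + n - + 2
signVectors⇒4∣n-2 {n} u v w su sv sw 4∣uv-2 4∣vw-2 4∣uw-2 =
  subst (+ 4 ∣_) (sym (regroup (+ n) (u ∙ v) (v ∙ w) (u ∙ w)))
    (∣m∣n⇒∣m-n (∣m∣n⇒∣m+n (∣m∣n⇒∣m+n (4∣n+u∙w-u∙v-v∙w u v w su sv sw) 4∣uv-2) 4∣vw-2) 4∣uw-2)
  where
  regroup : ∀ m a b c → m - + 2 ≡ (m + c - a - b) + (a - + 2) + (b - + 2) - (c - + 2)
  regroup = solve-∀

orthogonalSignVectors⇒4∣n : ∀ {n} (u v w : Fin n → ℤ) →
  (∀ k → IsSign (u k)) → (∀ k → IsSign (v k)) → (∀ k → IsSign (w k)) →
  u ∙ v ≡ + 0 → + 4 ∣ u ∙ w - + 2 → + 4 ∣ v ∙ w - + 2 →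
  + 4 ∣ + n
orthogonalSignVectors⇒4∣n {n} u v w su sv sw u⊥v 4∣uw-2 4∣vw-2 =
  subst (+ 4 ∣_) (sym (regroup (+ n) (u ∙ w) (v ∙ w)))
    (∣m∣n⇒∣m-n (∣m∣n⇒∣m+n 4∣n+uw-vw 4∣vw-2) 4∣uw-2)
  where
  4∣n+uw-vw : + 4 ∣ + n + u ∙ w - + 0 - v ∙ w
  4∣n+uw-vw = subst (λ x → + 4 ∣ + n + u ∙ w - x - v ∙ w) u⊥v (4∣n+u∙w-u∙v-v∙w u v w su sv sw)
  regroup : ∀ m a b → m ≡ (m + a - + 0 - b) + (b - + 2) - (a - + 2)
  regroup = solve-∀

4∤-1 : ¬ (+ 4 ∣ - (+ 1))
4∤-1 4∣-1 with ℕ.∣⇒≤ (∣⇒∣ᵤ 4∣-1)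
... | s≤s ()

4∤2 : ¬ (+ 4 ∣ + 2)
4∤2 4∣2 with ℕ.∣⇒≤ (∣⇒∣ᵤ 4∣2)
... | s≤s (s≤s ())

4∣m⇒4∤m-2 : ∀ {m} → + 4 ∣ m → ¬ (+ 4 ∣ m - + 2)
4∣m⇒4∤m-2 {m} 4∣m 4∣m-2 = 4∤2 (subst (+ 4 ∣_) (m-[m-2]≡2 m) (∣m∣n⇒∣m-n 4∣m 4∣m-2))
  where
  m-[m-2]≡2 : ∀ x → x - (x - + 2) ≡ + 2
  m-[m-2]≡2 = solve-∀

signs : ∀ {n H} → IsHadamard n H → ∀ i k → IsSign (H i k)
signs = proj₁

entries≡2 : ∀ {n H K} → WeaklyUnbiased n H K → ∀ i j → + 4 ∣ (H ·ᵀ K) i j - + 2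
entries≡2 wu i j = ∣ᵤ⇒∣ (proj₁ wu i j)

mutuallyWeaklyUnbiased₃⇒4∣n-2 : ∀ {n m F} →
  MutuallyWeaklyUnbiased (suc n) (suc (suc (suc m))) F → + 4 ∣ + suc n - + 2
mutuallyWeaklyUnbiased₃⇒4∣n-2 {F = F} (hadamard , unbiased) =
  signVectors⇒4∣n-2 (F 0F zero) (F 1F zero) (F 2F zero)
    (signs (hadamard 0F) zero) (signs (hadamard 1F) zero) (signs (hadamard 2F) zero)
    (entries≡2 {H = F 0F} {F 1F} (unbiased 0F 1F λ ()) zero zero)
    (entries≡2 {H = F 1F} {F 2F} (unbiased 1F 2F λ ()) zero zero)
    (entries≡2 {H = F 0F} {F 2F} (unbiased 0F 2F λ ()) zero zero)
  where
  0F 1F 2F : Fin _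
  0F = zero
  1F = suc zero
  2F = suc (suc zero)

weaklyUnbiased⇒4∣n : ∀ {n H K} → IsHadamard (suc (suc n)) H → IsPM1 K →
  WeaklyUnbiased (suc (suc n)) H K → + 4 ∣ + suc (suc n)
weaklyUnbiased⇒4∣n {H = H} {K} hH sK wHK =
  orthogonalSignVectors⇒4∣n (H zero) (H (suc zero)) (K zero)
    (signs hH zero) (signs hH (suc zero)) (sK zero)
    (proj₂ (proj₂ hH zero (suc zero)) λ ())
    (entries≡2 {H = H} {K} wHK zero zero)
    (entries≡2 {H = H} {K} wHK (suc zero) zero)

theorem6p1 : (n : ℕ) → 1 ≤ n → (m : ℕ) → (F : Fin m → Matrix n) →
    (∀ a b → (∀ i j → F a i j ≡ F b i j) → a ≡ b) →
    MutuallyWeaklyUnbiased n m F → m ≤ 2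
theorem6p1 _ _ zero             _ _ _ = z≤n
theorem6p1 _ _ (suc zero)       _ _ _ = s≤s z≤n
theorem6p1 _ _ (suc (suc zero)) _ _ _ = s≤s (s≤s z≤n)
theorem6p1 zero () (suc (suc (suc _))) _ _ _
theorem6p1 (suc zero) _ (suc (suc (suc _))) _ _ mwu =
  ⊥-elim (4∤-1 (mutuallyWeaklyUnbiased₃⇒4∣n-2 mwu))
theorem6p1 (suc (suc n)) _ (suc (suc (suc _))) _ _ mwu@(hadamard , unbiased) =
  ⊥-elim (4∣m⇒4∤m-2 4∣n (mutuallyWeaklyUnbiased₃⇒4∣n-2 mwu))
  where
  4∣n : + 4 ∣ + suc (suc n)
  4∣n = weaklyUnbiased⇒4∣n (hadamard zero) (signs (hadamard (suc zero)))
                           (unbiased zero (suc zero) λ ())
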